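{- For every $n\ge1$, the number of ascent sequences of length $n$ avoiding the pattern $102$ is $(3^{n-1}+1)/2$.
   Context: An ascent sequence is a finite sequence $x_1x_2\ldots x_n$ of nonnegative integers with $x_1=0$ and $x_i\le \operatorname{asc}(x_1\ldots x_{i-1})+1$ for all $1<i\le n$, where $\operatorname{asc}(y_1\ldots y_k)$ is the number of indices $j$ with $y_j<y_{j+1}$. Avoiding $102$ means there are no indices $i_1<i_2<i_3$ with $x_{i_2}<x_{i_1}<x_{i_3}$. -}

module Defs where

open import Data.Nat using (ℕ; zero; suc; _+_; _≤_; _<_; _<ᵇ_)
open import Data.Bool using (if_then_else_)
open import Data.Empty using (⊥)
open import Data.List using (List; []; _∷_; length; lookup)
open import Data.List.Relation.Unary.All using (All)
open import Data.Fin using (Fin) renaming (_<_ to _<ᶠ_)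
open import Data.Product using (Σ; _×_; ∃-syntax)
open import Relation.Nullary using (¬_)
open import Relation.Binary.PropositionalEquality using (_≡_)

asc : List ℕ → ℕ
asc [] = zero
asc (a ∷ []) = zero
asc (a ∷ b ∷ ys) = (if a <ᵇ b then 1 else 0) + asc (b ∷ ys)

-- x₁ … xₙ as a list; x_i (1-based) = lookup at index i-1.
-- An ascent sequence: nonempty, first entry 0, and for every position
-- i ≥ 1 (0-based) the entry is ≤ asc(take i xs) + 1.
open import Data.List using (take)
open import Data.Fin using (toℕ)

IsAscentSequence : List ℕ → Set
IsAscentSequence [] = ⊥
IsAscentSequence (x ∷ xs) =
  (x ≡ 0) ×
  ((i : Fin (length (x ∷ xs))) → 0 < toℕ i →
     lookup (x ∷ xs) i ≤ asc (take (toℕ i) (x ∷ xs)) + 1)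

Contains102 : List ℕ → Set
Contains102 xs = ∃[ i ] ∃[ j ] ∃[ k ]
  (i <ᶠ j) × (j <ᶠ k) ×
  (lookup xs j < lookup xs i) × (lookup xs i < lookup xs k)

Avoids102 : List ℕ → Set
Avoids102 xs = ¬ Contains102 xs

module Submission where

-- The 102-avoiding ascent sequences are enumerated by a generating tree.  A sequence
-- is built letter by letter from the root 0, and each prefix p is in one of two states:
--   free r   — p is weakly increasing and takes exactly the values 0, …, r (so asc p = r);
--              the legal next letters are 0, …, r + 1;
--   capped t — all values 0, …, t occur in p, t ≤ asc p, and appending c creates a 102
--              exactly when c > t; the legal next letters are 0, …, t.
-- Appending a letter a below the top/cap leads to capped (a + 1); appending t in capped t
-- stays in capped t; appending r or r + 1 in free r leads to free r or free (r + 1).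

open import Defs
open import Data.Nat using (ℕ; zero; suc; _+_; _*_; _^_; _≤_; _<_; z≤n; s≤s; _<ᵇ_)
open import Data.Nat.Properties
open import Data.Nat.Solver using (module +-*-Solver)
open import Data.Bool using (true; false; if_then_else_; T)
open import Data.Unit using (tt)
open import Data.Empty using (⊥; ⊥-elim)
open import Data.Sum using (_⊎_; inj₁; inj₂; [_,_])
open import Data.Product using (Σ; _×_; _,_; proj₁; proj₂; ∃-syntax)
open import Data.List using (List; []; _∷_; _++_; _∷ʳ_; length; take; lookup; map; applyUpTo; upTo)
open import Data.List.Properties
  using (length-++-≤ˡ; map-++; length-++; length-map; map-applyUpTo; upTo-∷ʳ; ++-assoc; ++-identityʳ; ∷-injectiveˡ; ∷-injectiveʳ)
open import Data.List.Membership.Propositional using (_∈_)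
open import Data.List.Membership.Propositional.Properties
  using (∈-map⁺; ∈-map⁻; ∈-++⁺ˡ; ∈-++⁺ʳ; ∈-++⁻; ∈-applyUpTo⁺; ∈-applyUpTo⁻)
open import Data.List.Relation.Unary.Any using (here; there)
open import Data.List.Relation.Unary.All using ([])
import Data.List.Relation.Unary.All as All
open import Data.List.Relation.Unary.AllPairs using (_∷_; [])
open import Data.List.Relation.Unary.Unique.Propositional using (Unique)
import Data.List.Relation.Unary.Unique.Propositional.Properties as Unique
open import Data.Fin using (Fin; toℕ; fromℕ<) renaming (zero to fzero; suc to fsuc)
open import Data.Fin.Properties using (toℕ<n; toℕ-fromℕ<)
open import Function.Bundles using (_⇔_; mk⇔; Equivalence)
open import Relation.Nullary using (¬_; yes; no)
open import Relation.Binary.PropositionalEquality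
  using (_≡_; refl; sym; trans; cong; cong₂; subst; subst₂; module ≡-Reasoning)

nth : List ℕ → ℕ → ℕ
nth []       _       = 0
nth (x ∷ xs) zero    = x
nth (x ∷ xs) (suc i) = nth xs i

nth≡lookup : ∀ (xs : List ℕ) (i : Fin (length xs)) → lookup xs i ≡ nth xs (toℕ i)
nth≡lookup (x ∷ xs) fzero    = refl
nth≡lookup (x ∷ xs) (fsuc i) = nth≡lookup xs i

fin-index : ∀ {n i} → i < n → ∃[ f ] toℕ {n} f ≡ i
fin-index i<n = fromℕ< i<n , toℕ-fromℕ< i<n

StartsWith0 : List ℕ → Set
StartsWith0 []      = ⊥
StartsWith0 (x ∷ _) = x ≡ 0

AscentBounded : List ℕ → Set
AscentBounded xs = ∀ i → i < length xs → 0 < i → nth xs i ≤ asc (take i xs) + 1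

Has102 : List ℕ → Set
Has102 xs = Σ ℕ λ i → Σ ℕ λ j → Σ ℕ λ k →
  i < j × j < k × k < length xs × nth xs j < nth xs i × nth xs i < nth xs k

record Valid (xs : List ℕ) : Set where
  constructor mkValid
  field
    starts  : StartsWith0 xs
    bounded : AscentBounded xs
    avoids  : ¬ Has102 xs

valid⇔ : ∀ xs → (IsAscentSequence xs × Avoids102 xs) ⇔ Valid xs
valid⇔ xs = mk⇔ (to xs) (from xs)
  where
  to : ∀ xs → IsAscentSequence xs × Avoids102 xs → Valid xs
  to (x ∷ xs) ((x≡0 , bnd) , avoid) = mkValid x≡0 bounded avoids
    where
    bounded : AscentBounded (x ∷ xs)
    bounded i i<n 0<i with f , refl ← fin-index i<n =
      subst (_≤ asc (take (toℕ f) (x ∷ xs)) + 1) (nth≡lookup (x ∷ xs) f) (bnd f 0<i)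
    avoids : ¬ Has102 (x ∷ xs)
    avoids (i , j , k , i<j , j<k , k<n , j<i , i<k)
      with fk , refl ← fin-index k<n
         | fj , refl ← fin-index (<-trans j<k k<n)
         | fi , refl ← fin-index (<-trans i<j (<-trans j<k k<n)) =
      avoid (fi , fj , fk , i<j , j<k ,
             subst₂ _<_ (sym (nth≡lookup (x ∷ xs) fj)) (sym (nth≡lookup (x ∷ xs) fi)) j<i ,
             subst₂ _<_ (sym (nth≡lookup (x ∷ xs) fi)) (sym (nth≡lookup (x ∷ xs) fk)) i<k)
  from : ∀ xs → Valid xs → IsAscentSequence xs × Avoids102 xs
  from (x ∷ xs) (mkValid x≡0 bounded avoids) =
    (x≡0 , λ f 0<f → subst (_≤ asc (take (toℕ f) (x ∷ xs)) + 1) (sym (nth≡lookup (x ∷ xs) f))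
                        (bounded (toℕ f) (toℕ<n f) 0<f)) ,
    λ (i , j , k , i<j , j<k , j<i , i<k) →
      avoids (toℕ i , toℕ j , toℕ k , i<j , j<k , toℕ<n k ,
              subst₂ _<_ (nth≡lookup (x ∷ xs) j) (nth≡lookup (x ∷ xs) i) j<i ,
              subst₂ _<_ (nth≡lookup (x ∷ xs) i) (nth≡lookup (x ∷ xs) k) i<k)

nth-++ˡ : ∀ p q {i} → i < length p → nth (p ++ q) i ≡ nth p i
nth-++ˡ (x ∷ p) q {zero}  _         = refl
nth-++ˡ (x ∷ p) q {suc i} (s≤s i<p) = nth-++ˡ p q i<p

nth-∷ʳ : ∀ p a → nth (p ∷ʳ a) (length p) ≡ a
nth-∷ʳ []      a = refl
nth-∷ʳ (x ∷ p) a = nth-∷ʳ p a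

take-++ˡ : ∀ (p q : List ℕ) {i} → i ≤ length p → take i (p ++ q) ≡ take i p
take-++ˡ p       q {zero}  _         = refl
take-++ˡ (x ∷ p) q {suc i} (s≤s i≤p) = cong (x ∷_) (take-++ˡ p q i≤p)

take-length : ∀ (p q : List ℕ) → take (length p) (p ++ q) ≡ p
take-length []      q = refl
take-length (x ∷ p) q = cong (x ∷_) (take-length p q)

length-∷ʳ : ∀ (p : List ℕ) a → length (p ∷ʳ a) ≡ suc (length p)
length-∷ʳ []      a = refl
length-∷ʳ (x ∷ p) a = cong suc (length-∷ʳ p a)

old<length-∷ʳ : ∀ (p : List ℕ) a {i} → i < length p → i < length (p ∷ʳ a)
old<length-∷ʳ p a i<p = <-≤-trans i<p (length-++-≤ˡ p)

new<length-∷ʳ : ∀ (p : List ℕ) a → length p < length (p ∷ʳ a)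
new<length-∷ʳ p a = ≤-reflexive (sym (length-∷ʳ p a))

index-∷ʳ : ∀ (p : List ℕ) a {i} → i < length (p ∷ʳ a) → i < length p ⊎ i ≡ length p
index-∷ʳ p a i<pa = m≤n⇒m<n∨m≡n (m<1+n⇒m≤n (subst (_ <_) (length-∷ʳ p a) i<pa))

nth-old : ∀ p a {i} → i < length p → nth (p ∷ʳ a) i ≡ nth p i
nth-old p a = nth-++ˡ p (a ∷ [])

lastv : List ℕ → ℕ
lastv []           = 0
lastv (x ∷ [])     = x
lastv (x ∷ y ∷ ys) = lastv (y ∷ ys)

lastv-∷ʳ : ∀ p a → lastv (p ∷ʳ a) ≡ a
lastv-∷ʳ []          a = refl
lastv-∷ʳ (x ∷ [])    a = refl
lastv-∷ʳ (x ∷ y ∷ p) a = lastv-∷ʳ (y ∷ p) a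

ascent : ℕ → ℕ → ℕ
ascent a b = if a <ᵇ b then 1 else 0

ascent-< : ∀ {a b} → a < b → ascent a b ≡ 1
ascent-< {a} {b} a<b with a <ᵇ b in eq
... | true  = refl
... | false = ⊥-elim (subst T eq (<⇒<ᵇ a<b))

ascent-≥ : ∀ {a b} → b ≤ a → ascent a b ≡ 0
ascent-≥ {a} {b} b≤a with a <ᵇ b in eq
... | false = refl
... | true  = ⊥-elim (<⇒≱ (<ᵇ⇒< a b (subst T (sym eq) tt)) b≤a)

asc-∷ʳ : ∀ p a → StartsWith0 p → asc (p ∷ʳ a) ≡ asc p + ascent (lastv p) a
asc-∷ʳ (x ∷ p) a _ = snoc x p
  where
  open ≡-Reasoning
  snoc : ∀ x p → asc ((x ∷ p) ∷ʳ a) ≡ asc (x ∷ p) + ascent (lastv (x ∷ p)) a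
  snoc x []      = +-comm (ascent x a) 0
  snoc x (y ∷ p) = begin
    ascent x y + asc ((y ∷ p) ∷ʳ a)                       ≡⟨ cong (ascent x y +_) (snoc y p) ⟩
    ascent x y + (asc (y ∷ p) + ascent (lastv (y ∷ p)) a) ≡⟨ sym (+-assoc (ascent x y) _ _) ⟩
    ascent x y + asc (y ∷ p) + ascent (lastv (y ∷ p)) a   ∎

asc-≤-∷ʳ : ∀ p a → StartsWith0 p → asc p ≤ asc (p ∷ʳ a)
asc-≤-∷ʳ p a st = subst (asc p ≤_) (sym (asc-∷ʳ p a st)) (m≤m+n _ _)

-- Appending c to p completes a 102 whose '1' and '0' already lie in p.
Forbidden : List ℕ → ℕ → Set
Forbidden p c = Σ ℕ λ i → Σ ℕ λ j →
  i < j × j < length p × nth p j < nth p i × nth p i < c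

Between : List ℕ → ℕ → ℕ → Set
Between p b c = Σ ℕ λ i → i < length p × b < nth p i × nth p i < c

Occurs : List ℕ → ℕ → Set
Occurs p v = Σ ℕ λ i → i < length p × nth p i ≡ v

Legal : List ℕ → ℕ → Set
Legal p a = a ≤ asc p + 1 × ¬ Forbidden p a

occurs-∷ʳ : ∀ p a {v} → Occurs p v → Occurs (p ∷ʳ a) v
occurs-∷ʳ p a (i , i<p , e) = i , old<length-∷ʳ p a i<p , trans (nth-old p a i<p) e

occurs-last : ∀ p a → Occurs (p ∷ʳ a) a
occurs-last p a = length p , new<length-∷ʳ p a , nth-∷ʳ p a

has102-∷ʳ : ∀ p a → Has102 (p ∷ʳ a) → Has102 p ⊎ Forbidden p a
has102-∷ʳ p a (i , j , k , i<j , j<k , k<pa , j<i , i<k) with index-∷ʳ p a k<pa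
... | inj₁ k<p = inj₁ (i , j , k , i<j , j<k , k<p ,
        subst₂ _<_ (nth-old p a j<p) (nth-old p a i<p) j<i ,
        subst₂ _<_ (nth-old p a i<p) (nth-old p a k<p) i<k)
  where j<p = <-trans j<k k<p
        i<p = <-trans i<j j<p
... | inj₂ refl = inj₂ (i , j , i<j , j<k ,
        subst₂ _<_ (nth-old p a j<k) (nth-old p a i<p) j<i ,
        subst₂ _<_ (nth-old p a i<p) (nth-∷ʳ p a) i<k)
  where i<p = <-trans i<j j<k

forbidden⇒has102 : ∀ p a → Forbidden p a → Has102 (p ∷ʳ a)
forbidden⇒has102 p a (i , j , i<j , j<p , j<i , i<a) =
  i , j , length p , i<j , j<p , new<length-∷ʳ p a ,
  subst₂ _<_ (sym (nth-old p a j<p)) (sym (nth-old p a i<p)) j<i ,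
  subst₂ _<_ (sym (nth-old p a i<p)) (sym (nth-∷ʳ p a)) i<a
  where i<p = <-trans i<j j<p

forbidden-∷ʳ⁻ : ∀ p b c → Forbidden (p ∷ʳ b) c → Forbidden p c ⊎ Between p b c
forbidden-∷ʳ⁻ p b c (i , j , i<j , j<pb , j<i , i<c) with index-∷ʳ p b j<pb
... | inj₁ j<p = inj₁ (i , j , i<j , j<p ,
        subst₂ _<_ (nth-old p b j<p) (nth-old p b i<p) j<i ,
        subst (_< c) (nth-old p b i<p) i<c)
  where i<p = <-trans i<j j<p
... | inj₂ refl = inj₂ (i , i<j ,
        subst₂ _<_ (nth-∷ʳ p b) (nth-old p b i<j) j<i ,
        subst (_< c) (nth-old p b i<j) i<c)

forbidden-∷ʳ⁺ : ∀ p b c → Forbidden p c ⊎ Between p b c → Forbidden (p ∷ʳ b) c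
forbidden-∷ʳ⁺ p b c (inj₁ (i , j , i<j , j<p , j<i , i<c)) =
  i , j , i<j , old<length-∷ʳ p b j<p ,
  subst₂ _<_ (sym (nth-old p b j<p)) (sym (nth-old p b i<p)) j<i ,
  subst (_< c) (sym (nth-old p b i<p)) i<c
  where i<p = <-trans i<j j<p
forbidden-∷ʳ⁺ p b c (inj₂ (i , i<p , b<i , i<c)) =
  i , length p , i<p , new<length-∷ʳ p b ,
  subst₂ _<_ (sym (nth-∷ʳ p b)) (sym (nth-old p b i<p)) b<i ,
  subst (_< c) (sym (nth-old p b i<p)) i<c

valid-∷ʳ : ∀ p a → Valid p → Legal p a → Valid (p ∷ʳ a)
valid-∷ʳ p@(x ∷ _) a (mkValid x≡0 bounded avoids) (a≤ , allowed) =
  mkValid x≡0 bounded′ λ h → [ avoids , allowed ] (has102-∷ʳ p a h)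
  where
  bounded′ : AscentBounded (p ∷ʳ a)
  bounded′ i i<pa 0<i with index-∷ʳ p a i<pa
  ... | inj₁ i<p = subst₂ (λ u w → u ≤ asc w + 1)
                     (sym (nth-old p a i<p)) (sym (take-++ˡ p _ (<⇒≤ i<p))) (bounded i i<p 0<i)
  ... | inj₂ refl = subst₂ (λ u w → u ≤ asc w + 1) (sym (nth-∷ʳ p a)) (sym (take-length p _)) a≤

valid-prefix : ∀ p q → StartsWith0 p → Valid (p ++ q) → Valid p
valid-prefix p@(x ∷ _) q x≡0 (mkValid _ bounded avoids) =
  mkValid x≡0 bounded′ λ h → avoids (extend h)
  where
  bounded′ : AscentBounded p
  bounded′ i i<p 0<i = subst₂ (λ u w → u ≤ asc w + 1) (nth-++ˡ p q i<p) (take-++ˡ p q (<⇒≤ i<p))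
    (bounded i (<-≤-trans i<p (length-++-≤ˡ p)) 0<i)
  extend : Has102 p → Has102 (p ++ q)
  extend (i , j , k , i<j , j<k , k<p , j<i , i<k) =
    i , j , k , i<j , j<k , <-≤-trans k<p (length-++-≤ˡ p) ,
    subst₂ _<_ (sym (nth-++ˡ p q j<p)) (sym (nth-++ˡ p q i<p)) j<i ,
    subst₂ _<_ (sym (nth-++ˡ p q i<p)) (sym (nth-++ˡ p q k<p)) i<k
    where j<p = <-trans j<k k<p
          i<p = <-trans i<j j<p

valid⇒legal : ∀ p a zs → StartsWith0 p → Valid ((p ∷ʳ a) ++ zs) → Legal p a
valid⇒legal p@(x ∷ _) a zs x≡0 v with mkValid _ bounded avoids ← valid-prefix (p ∷ʳ a) zs x≡0 v =
  subst₂ (λ u w → u ≤ asc w + 1) (nth-∷ʳ p a) (take-length p _)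
    (bounded (length p) (new<length-∷ʳ p a) (s≤s z≤n)) ,
  λ f → avoids (forbidden⇒has102 p a f)

data State : Set where
  free   : ℕ → State
  capped : ℕ → State

dip : ℕ → ℕ × State
dip a = a , capped (suc a)

choices : State → List (ℕ × State)
choices (capped t) = applyUpTo dip t ++ (t , capped t) ∷ []
choices (free r)   = applyUpTo dip r ++ (r , free r) ∷ (suc r , free (suc r)) ∷ []

mutual
  gen : State → ℕ → List (List ℕ)
  gen s zero    = [] ∷ []
  gen s (suc k) = genFrom (choices s) k

  genFrom : List (ℕ × State) → ℕ → List (List ℕ)
  genFrom []              k = []
  genFrom ((a , s) ∷ cs) k = map (a ∷_) (gen s k) ++ genFrom cs k

genFrom-∈⁻ : ∀ cs k {ys} → ys ∈ genFrom cs k →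
  ∃[ a ] ∃[ s ] ∃[ zs ] ((a , s) ∈ cs × ys ≡ a ∷ zs × zs ∈ gen s k)
genFrom-∈⁻ ((a , s) ∷ cs) k ys∈ with ∈-++⁻ (map (a ∷_) (gen s k)) ys∈
... | inj₁ ys∈a with zs , zs∈ , e ← ∈-map⁻ (a ∷_) ys∈a = a , s , zs , here refl , e , zs∈
... | inj₂ ys∈cs with b , s′ , zs , bs∈ , e , zs∈ ← genFrom-∈⁻ cs k ys∈cs =
  b , s′ , zs , there bs∈ , e , zs∈

genFrom-∈⁺ : ∀ cs k {a s zs} → (a , s) ∈ cs → zs ∈ gen s k → (a ∷ zs) ∈ genFrom cs k
genFrom-∈⁺ ((b , s′) ∷ cs) k (here refl) zs∈ = ∈-++⁺ˡ (∈-map⁺ (_ ∷_) zs∈)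
genFrom-∈⁺ ((b , s′) ∷ cs) k (there as∈) zs∈ =
  ∈-++⁺ʳ (map (b ∷_) (gen s′ k)) (genFrom-∈⁺ cs k as∈ zs∈)

letters : State → List ℕ
letters s = map proj₁ (choices s)

letters-dips : ∀ n rest → map proj₁ (applyUpTo dip n ++ rest) ≡ upTo n ++ map proj₁ rest
letters-dips n rest = trans (map-++ proj₁ (applyUpTo dip n) rest)
                            (cong (_++ _) (map-applyUpTo dip proj₁ n))

letters≡upTo : ∀ s → Σ ℕ λ n → letters s ≡ upTo n
letters≡upTo (capped t) = suc t , trans (letters-dips t _) (upTo-∷ʳ t)
letters≡upTo (free r)   = suc (suc r) , (begin
  letters (free r)                ≡⟨ letters-dips r _ ⟩
  upTo r ++ r ∷ suc r ∷ []        ≡⟨ sym (++-assoc (upTo r) (r ∷ []) (suc r ∷ [])) ⟩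
  (upTo r ∷ʳ r) ∷ʳ suc r          ≡⟨ cong (_∷ʳ suc r) (upTo-∷ʳ r) ⟩
  upTo (suc r) ∷ʳ suc r           ≡⟨ upTo-∷ʳ (suc r) ⟩
  upTo (suc (suc r))              ∎)
  where open ≡-Reasoning

letters-unique : ∀ s → Unique (letters s)
letters-unique s with n , e ← letters≡upTo s = subst Unique (sym e) (Unique.upTo⁺ n)

-- Distinct letters lead to disjoint sets of words, so no word is generated twice.
mutual
  gen-unique : ∀ s k → Unique (gen s k)
  gen-unique s zero    = [] ∷ []
  gen-unique s (suc k) = genFrom-unique (choices s) k (letters-unique s)

  genFrom-unique : ∀ cs k → Unique (map proj₁ cs) → Unique (genFrom cs k)
  genFrom-unique []             k _            = []
  genFrom-unique ((a , s) ∷ cs) k (a∉cs ∷ u) =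
    Unique.++⁺ (Unique.map⁺ ∷-injectiveʳ (gen-unique s k)) (genFrom-unique cs k u) disjoint
    where
    disjoint : ∀ {ys} → ¬ (ys ∈ map (a ∷_) (gen s k) × ys ∈ genFrom cs k)
    disjoint (ys∈a , ys∈cs) with _ , _ , refl ← ∈-map⁻ (a ∷_) ys∈a
                               | b , _ , _ , bs∈ , e , _ ← genFrom-∈⁻ cs k ys∈cs =
      All.lookup a∉cs (∈-map⁺ proj₁ bs∈) (∷-injectiveˡ e)

mutual
  count : State → ℕ → ℕ
  count s zero    = 1
  count s (suc k) = countFrom (choices s) k

  countFrom : List (ℕ × State) → ℕ → ℕ
  countFrom []             k = 0
  countFrom ((a , s) ∷ cs) k = count s k + countFrom cs k

mutual
  length-gen : ∀ s k → length (gen s k) ≡ count s k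
  length-gen s zero    = refl
  length-gen s (suc k) = length-genFrom (choices s) k

  length-genFrom : ∀ cs k → length (genFrom cs k) ≡ countFrom cs k
  length-genFrom []             k = refl
  length-genFrom ((a , s) ∷ cs) k = begin
    length (map (a ∷_) (gen s k) ++ genFrom cs k)          ≡⟨ length-++ (map (a ∷_) (gen s k)) ⟩
    length (map (a ∷_) (gen s k)) + length (genFrom cs k)  ≡⟨ cong₂ _+_ (length-map (a ∷_) (gen s k))
                                                                         (length-genFrom cs k) ⟩
    length (gen s k) + countFrom cs k                      ≡⟨ cong (_+ _) (length-gen s k) ⟩
    count s k + countFrom cs k                             ∎
    where open ≡-Reasoning

up : State → State
up (free r)   = free (suc r)
up (capped t) = capped (suc t)

shift : ℕ × State → ℕ × State
shift (a , s) = suc a , up s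

shift-dips : ∀ n rest →
  map shift (applyUpTo dip n ++ rest) ≡ applyUpTo (λ a → dip (suc a)) n ++ map shift rest
shift-dips n rest = trans (map-++ shift (applyUpTo dip n) rest) (cong (_++ _) (map-applyUpTo dip shift n))

choices-up : ∀ s → choices (up s) ≡ (0 , capped 1) ∷ map shift (choices s)
choices-up (capped t) = cong ((0 , capped 1) ∷_) (sym (shift-dips t _))
choices-up (free r)   = cong ((0 , capped 1) ∷_) (sym (shift-dips r _))

count-up : ∀ s k → count (up s) (suc k) ≡ count (capped 1) k + countFrom (map shift (choices s)) k
count-up s k = cong (λ cs → countFrom cs k) (choices-up s)

countFrom-zero : ∀ cs → countFrom cs 0 ≡ length cs
countFrom-zero []       = refl
countFrom-zero (c ∷ cs) = cong suc (countFrom-zero cs)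

open +-*-Solver

-- The growth identity: with U k = count (up s) k and C k = count s k,
-- U (k + 1) − 2 U k = C (k + 1) − C k, written without subtraction.
mutual
  growth : ∀ k s → count (up s) (suc k) + count s k ≡ count s (suc k) + 2 * count (up s) k
  growth zero s = begin
    count (up s) 1 + 1                          ≡⟨ cong (_+ 1) (count-up s 0) ⟩
    1 + countFrom (map shift (choices s)) 0 + 1 ≡⟨ cong (λ n → 1 + n + 1) shifted-length ⟩
    1 + countFrom (choices s) 0 + 1             ≡⟨ solve 1 (λ n → con 1 :+ n :+ con 1 := n :+ con 2 :* con 1)
                                                         refl (countFrom (choices s) 0) ⟩
    countFrom (choices s) 0 + 2 * 1             ∎
    where
    open ≡-Reasoning
    shifted-length : countFrom (map shift (choices s)) 0 ≡ countFrom (choices s) 0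
    shifted-length = begin
      countFrom (map shift (choices s)) 0 ≡⟨ countFrom-zero (map shift (choices s)) ⟩
      length (map shift (choices s))      ≡⟨ length-map shift (choices s) ⟩
      length (choices s)                  ≡⟨ sym (countFrom-zero (choices s)) ⟩
      countFrom (choices s) 0             ∎
  growth (suc k) s = begin
    count (up s) (suc (suc k)) + Z       ≡⟨ cong (_+ Z) (count-up s (suc k)) ⟩
    X + (X + 0) + Y + Z                  ≡⟨ solve 3 (λ X Y Z → X :+ (X :+ con 0) :+ Y :+ Z := X :+ X :+ (Y :+ Z))
                                                  refl X Y Z ⟩
    X + X + (Y + Z)                      ≡⟨ cong (X + X +_) (growthFrom k (choices s)) ⟩
    X + X + (W + 2 * V)                  ≡⟨ solve 3 (λ X W V → X :+ X :+ (W :+ con 2 :* V) := W :+ con 2 :* (X :+ V))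
                                                  refl X W V ⟩
    W + 2 * (X + V)                      ≡⟨ cong (λ n → W + 2 * n) (sym (count-up s k)) ⟩
    W + 2 * count (up s) (suc k)         ∎
    where
    open ≡-Reasoning
    X = count (capped 1) k
    Y = countFrom (map shift (choices s)) (suc k)
    Z = countFrom (choices s) k
    W = countFrom (choices s) (suc k)
    V = countFrom (map shift (choices s)) k

  growthFrom : ∀ k cs →
    countFrom (map shift cs) (suc k) + countFrom cs k ≡ countFrom cs (suc k) + 2 * countFrom (map shift cs) k
  growthFrom k []             = refl
  growthFrom k ((a , s) ∷ cs) = begin
    (P + Q) + (R + S)                    ≡⟨ solve 4 (λ P Q R S → (P :+ Q) :+ (R :+ S) := (P :+ R) :+ (Q :+ S))
                                                  refl P Q R S ⟩
    (P + R) + (Q + S)                    ≡⟨ cong₂ _+_ (growth k s) (growthFrom k cs) ⟩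
    (count s (suc k) + 2 * count (up s) k) + (countFrom cs (suc k) + 2 * countFrom (map shift cs) k)
      ≡⟨ solve 4 (λ a b c d → (a :+ con 2 :* b) :+ (c :+ con 2 :* d) := (a :+ c) :+ con 2 :* (b :+ d))
                 refl (count s (suc k)) (count (up s) k) (countFrom cs (suc k)) (countFrom (map shift cs) k) ⟩
    (count s (suc k) + countFrom cs (suc k)) + 2 * (count (up s) k + countFrom (map shift cs) k) ∎
    where
    open ≡-Reasoning
    P = count (up s) (suc k)
    Q = countFrom (map shift cs) (suc k)
    R = count s k
    S = countFrom cs k

-- The subtree below free 1 triples in size at each level (growth identity at free 0).
count-free1 : ∀ k → count (free 1) k ≡ 3 ^ k
count-free1 zero    = refl
count-free1 (suc k) = +-cancelʳ-≡ F0 _ _ (begin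
  count (free 1) (suc k) + F0          ≡⟨ growth k (free 0) ⟩
  F0 + (F1 + 0) + 2 * F1               ≡⟨ solve 2 (λ a b → a :+ (b :+ con 0) :+ con 2 :* b := con 3 :* b :+ a)
                                               refl F0 F1 ⟩
  3 * F1 + F0                          ≡⟨ cong (λ n → 3 * n + F0) (count-free1 k) ⟩
  3 * 3 ^ k + F0                       ∎)
  where
  open ≡-Reasoning
  F0 = count (free 0) k
  F1 = count (free 1) k

-- Level k below free 0: the sequences of length k + 1, counted in the theorem.
count-free0 : ∀ k → 2 * count (free 0) k ≡ 3 ^ k + 1
count-free0 zero    = refl
count-free0 (suc k) = begin
  2 * (F0 + (F1 + 0))                  ≡⟨ solve 2 (λ a b → con 2 :* (a :+ (b :+ con 0)) := con 2 :* a :+ con 2 :* b)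
                                               refl F0 F1 ⟩
  2 * F0 + 2 * F1                      ≡⟨ cong₂ (λ a b → a + 2 * b) (count-free0 k) (count-free1 k) ⟩
  3 ^ k + 1 + 2 * 3 ^ k                ≡⟨ solve 1 (λ x → x :+ con 1 :+ con 2 :* x := con 3 :* x :+ con 1) refl (3 ^ k) ⟩
  3 * 3 ^ k + 1                        ∎
  where
  open ≡-Reasoning
  F0 = count (free 0) k
  F1 = count (free 1) k

record Below (p : List ℕ) (t : ℕ) : Set where
  field
    valid      : Valid p
    covers     : ∀ v → v ≤ t → Occurs p v
    cap≤asc    : t ≤ asc p
    forbidden> : ∀ c → Forbidden p c → t < c

record Capped (p : List ℕ) (t : ℕ) : Set where
  field
    below      : Below p t
    forbidden< : ∀ c → t < c → Forbidden p c

record Free (p : List ℕ) (r : ℕ) : Set where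
  field
    valid     : Valid p
    covers    : ∀ v → v ≤ r → Occurs p v
    bounded   : ∀ i → i < length p → nth p i ≤ r
    ascents   : asc p ≡ r
    ends-in   : lastv p ≡ r
    unblocked : ∀ c → ¬ Forbidden p c

Inv : List ℕ → State → Set
Inv p (free r)   = Free p r
Inv p (capped t) = Capped p t

Inv⇒Valid : ∀ p s → Inv p s → Valid p
Inv⇒Valid p (free r)   inv = Free.valid inv
Inv⇒Valid p (capped t) inv = Below.valid (Capped.below inv)

Free⇒Below : ∀ {p r} → Free p r → Below p r
Free⇒Below inv = record
  { valid      = valid
  ; covers     = covers
  ; cap≤asc    = ≤-reflexive (sym ascents)
  ; forbidden> = λ c f → ⊥-elim (unblocked c f)
  }
  where open Free inv

legal-below : ∀ {p t a} → Below p t → a ≤ t → Legal p a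
legal-below {a = a} inv a≤t = ≤-trans a≤t (≤-trans cap≤asc (m≤m+n _ 1)) , λ f → <⇒≱ (forbidden> a f) a≤t
  where open Below inv

dip-step : ∀ {p t a} → Below p t → a < t → Capped (p ∷ʳ a) (suc a)
dip-step {p} {t} {a} inv a<t = record
  { below = record
    { valid      = valid-∷ʳ p a valid (legal-below inv (<⇒≤ a<t))
    ; covers     = λ v v≤a+1 → occurs-∷ʳ p a (covers v (≤-trans v≤a+1 a<t))
    ; cap≤asc    = ≤-trans a<t (≤-trans cap≤asc (asc-≤-∷ʳ p a (Valid.starts valid)))
    ; forbidden> = λ c f → [ (λ f′ → <-≤-trans (s≤s a<t) (forbidden> c f′))
                           , (λ (_ , _ , a<x , x<c) → ≤-<-trans a<x x<c)
                           ] (forbidden-∷ʳ⁻ p a c f)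
    }
  ; forbidden< = λ c a+1<c → forbidden-∷ʳ⁺ p a c (inj₂ (between c a+1<c (covers (suc a) a<t)))
  }
  where
  open Below inv
  between : ∀ c → suc a < c → Occurs p (suc a) → Between p a c
  between c a+1<c (i , i<p , x≡a+1) = i , i<p , ≤-reflexive (sym x≡a+1) , subst (_< c) (sym x≡a+1) a+1<c

stay-step : ∀ {p t} → Capped p t → Capped (p ∷ʳ t) t
stay-step {p} {t} inv = record
  { below = record
    { valid      = valid-∷ʳ p t valid (legal-below below ≤-refl)
    ; covers     = λ v v≤t → occurs-∷ʳ p t (covers v v≤t)
    ; cap≤asc    = ≤-trans cap≤asc (asc-≤-∷ʳ p t (Valid.starts valid))
    ; forbidden> = λ c f → [ forbidden> c , (λ (_ , _ , t<x , x<c) → <-trans t<x x<c) ] (forbidden-∷ʳ⁻ p t c f)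
    }
  ; forbidden< = λ c t<c → forbidden-∷ʳ⁺ p t c (inj₁ (forbidden< c t<c))
  }
  where
  open Capped inv
  open Below below

legal-free : ∀ {p r a} → Free p r → a ≤ suc r → Legal p a
legal-free {a = a} inv a≤r+1 = subst (a ≤_) (trans (+-comm 1 _) (cong (_+ 1) (sym ascents))) a≤r+1 , unblocked a
  where open Free inv

climb-step : ∀ {p r a} → Free p r → r ≤ a → a ≤ suc r → Free (p ∷ʳ a) a
climb-step {p} {r} {a} inv r≤a a≤r+1 = record
  { valid     = valid-∷ʳ p a valid (legal-free inv a≤r+1)
  ; covers    = covers′
  ; bounded   = bounded′
  ; ascents   = begin
      asc (p ∷ʳ a)                 ≡⟨ asc-∷ʳ p a (Valid.starts valid) ⟩
      asc p + ascent (lastv p) a   ≡⟨ cong₂ (λ m n → m + ascent n a) ascents ends-in ⟩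
      r + ascent r a               ≡⟨ top-step ⟩
      a                            ∎
  ; ends-in   = lastv-∷ʳ p a
  ; unblocked = λ c f → [ unblocked c , (λ (i , i<p , a<x , _) → <⇒≱ a<x (≤-trans (bounded i i<p) r≤a)) ]
                          (forbidden-∷ʳ⁻ p a c f)
  }
  where
  open Free inv
  open ≡-Reasoning
  top-step : r + ascent r a ≡ a
  top-step with m≤n⇒m<n∨m≡n r≤a
  ... | inj₂ refl = trans (cong (r +_) (ascent-≥ {r} ≤-refl)) (+-identityʳ r)
  ... | inj₁ r<a  = trans (cong (r +_) (ascent-< r<a)) (trans (+-comm r 1) (≤-antisym r<a a≤r+1))
  covers′ : ∀ v → v ≤ a → Occurs (p ∷ʳ a) v
  covers′ v v≤a with v ≤? r
  ... | yes v≤r = occurs-∷ʳ p a (covers v v≤r)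
  ... | no  v≰r with ≤-antisym v≤a (≤-trans a≤r+1 (≰⇒> v≰r))
  ...   | refl = occurs-last p a
  bounded′ : ∀ i → i < length (p ∷ʳ a) → nth (p ∷ʳ a) i ≤ a
  bounded′ i i<pa with index-∷ʳ p a i<pa
  ... | inj₁ i<p  = subst (_≤ a) (sym (nth-old p a i<p)) (≤-trans (bounded i i<p) r≤a)
  ... | inj₂ refl = ≤-reflexive (nth-∷ʳ p a)

∈-dips⁻ : ∀ n rest {a s} → (a , s) ∈ applyUpTo dip n ++ rest →
  (a < n × s ≡ capped (suc a)) ⊎ (a , s) ∈ rest
∈-dips⁻ n rest as∈ with ∈-++⁻ (applyUpTo dip n) as∈
... | inj₂ as∈rest = inj₂ as∈rest
... | inj₁ as∈dips with i , i<n , refl ← ∈-applyUpTo⁻ dip as∈dips = inj₁ (i<n , refl)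

∈-dips⁺ : ∀ {n a} rest → a < n → (a , capped (suc a)) ∈ applyUpTo dip n ++ rest
∈-dips⁺ rest a<n = ∈-++⁺ˡ (∈-applyUpTo⁺ dip a<n)

step : ∀ p s {a s′} → Inv p s → (a , s′) ∈ choices s → Inv (p ∷ʳ a) s′
step p (capped t) inv as∈ with ∈-dips⁻ t _ as∈
... | inj₁ (a<t , refl) = dip-step (Capped.below inv) a<t
... | inj₂ (here refl)  = stay-step inv
step p (free r) inv as∈ with ∈-dips⁻ r _ as∈
... | inj₁ (a<r , refl)        = dip-step (Free⇒Below inv) a<r
... | inj₂ (here refl)         = climb-step inv ≤-refl (n≤1+n r)
... | inj₂ (there (here refl)) = climb-step inv (n≤1+n r) ≤-refl

choice-for : ∀ p s {a} → Inv p s → Legal p a → ∃[ s′ ] (a , s′) ∈ choices s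
choice-for p (capped t) {a} inv (_ , allowed)
  with m≤n⇒m<n∨m≡n (≮⇒≥ (λ t<a → allowed (Capped.forbidden< inv a t<a)))
... | inj₁ a<t  = capped (suc a) , ∈-dips⁺ _ a<t
... | inj₂ refl = capped t , ∈-++⁺ʳ (applyUpTo dip t) (here refl)
choice-for p (free r) {a} inv (a≤asc+1 , _)
  with m≤n⇒m<n∨m≡n (subst (a ≤_) (trans (cong (_+ 1) (Free.ascents inv)) (+-comm r 1)) a≤asc+1)
... | inj₂ refl = free (suc r) , ∈-++⁺ʳ (applyUpTo dip r) (there (here refl))
... | inj₁ (s≤s a≤r) with m≤n⇒m<n∨m≡n a≤r
...   | inj₁ a<r  = capped (suc a) , ∈-dips⁺ _ a<r
...   | inj₂ refl = free r , ∈-++⁺ʳ (applyUpTo dip r) (here refl)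

sound : ∀ k s p {ys} → Inv p s → ys ∈ gen s k → Valid (p ++ ys) × length ys ≡ k
sound zero    s p inv (here refl) = subst Valid (sym (++-identityʳ p)) (Inv⇒Valid p s inv) , refl
sound (suc k) s p inv ys∈
  with a , s′ , zs , as∈ , refl , zs∈ ← genFrom-∈⁻ (choices s) k ys∈
  with v , len ← sound k s′ (p ∷ʳ a) (step p s inv as∈) zs∈ =
  subst Valid (++-assoc p (a ∷ []) zs) v , cong suc len

complete : ∀ k s p ys → Inv p s → Valid (p ++ ys) → length ys ≡ k → ys ∈ gen s k
complete zero    s p []       inv v len = here refl
complete (suc k) s p (a ∷ zs) inv v len =
  genFrom-∈⁺ (choices s) k a∈ (complete k s′ (p ∷ʳ a) zs (step p s inv a∈) v′ (suc-injective len))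
  where
  v′ : Valid ((p ∷ʳ a) ++ zs)
  v′ = subst Valid (sym (++-assoc p (a ∷ []) zs)) v
  next : ∃[ s′ ] (a , s′) ∈ choices s
  next = choice-for p s inv (valid⇒legal p a zs (Valid.starts (Inv⇒Valid p s inv)) v′)
  s′ = proj₁ next
  a∈ = proj₂ next

root : Free (0 ∷ []) 0
root = record
  { valid     = mkValid refl (λ { zero _ () ; (suc i) (s≤s ()) _ })
                             (λ { (_ , _ , _ , _ , () , s≤s z≤n , _) })
  ; covers    = λ { zero _ → 0 , s≤s z≤n , refl }
  ; bounded   = λ { zero _ → z≤n ; (suc i) (s≤s ()) }
  ; ascents   = refl
  ; ends-in   = refl
  ; unblocked = λ { _ (_ , _ , () , s≤s z≤n , _) }
  }

enumeration : ∀ m xs →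
  xs ∈ map (0 ∷_) (gen (free 0) m) ⇔ (IsAscentSequence xs × Avoids102 xs × length xs ≡ suc m)
enumeration m xs = mk⇔ to from
  where
  to : ∀ {xs} → xs ∈ map (0 ∷_) (gen (free 0) m) → IsAscentSequence xs × Avoids102 xs × length xs ≡ suc m
  to xs∈ with ys , ys∈ , refl ← ∈-map⁻ (0 ∷_) xs∈
         with v , len ← sound m (free 0) (0 ∷ []) root ys∈
         with asc-seq , avoids ← Equivalence.from (valid⇔ (0 ∷ ys)) v = asc-seq , avoids , cong suc len
  from : ∀ {xs} → IsAscentSequence xs × Avoids102 xs × length xs ≡ suc m → xs ∈ map (0 ∷_) (gen (free 0) m)
  from {x ∷ ys} (asc-seq , avoids , len) with Equivalence.to (valid⇔ (x ∷ ys)) (asc-seq , avoids)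
  ... | v@(mkValid refl _ _) = ∈-map⁺ (0 ∷_) (complete m (free 0) (0 ∷ []) ys root v (suc-injective len))

theorem2p8 : (m : ℕ) →
    ∃[ L ] (Unique L ×
      ((xs : List ℕ) → (xs ∈ L ⇔ (IsAscentSequence xs × Avoids102 xs × length xs ≡ suc m))) ×
      (2 * length L ≡ 3 ^ m + 1))
theorem2p8 m =
  map (0 ∷_) (gen (free 0) m) ,
  Unique.map⁺ ∷-injectiveʳ (gen-unique (free 0) m) ,
  enumeration m ,
  (begin
    2 * length (map (0 ∷_) (gen (free 0) m)) ≡⟨ cong (2 *_) (length-map (0 ∷_) (gen (free 0) m)) ⟩
    2 * length (gen (free 0) m)              ≡⟨ cong (2 *_) (length-gen (free 0) m) ⟩
    2 * count (free 0) m                     ≡⟨ count-free0 m ⟩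
    3 ^ m + 1                                ∎)
  where open ≡-Reasoning
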